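{- Let $P,Q$ be finite posets with $|P|=p$, $|Q|=q$, let $D_\lambda\in\mathfrak{D}_n$, $R=P\oplus D_\lambda\oplus Q$, and let $1\le i$, $i+1<j<k\le p+n+q$. If $i\le p$ or $k-j\le p$, then for every linear extension $f$ of $R$, $(t_iq_{jk})^2(f)$ agrees with $f$ on every element of $D_\lambda$.
   Context: For a finite poset $X$ with $|X|=N$, a linear extension is a bijection $f:X\to\{1,\ldots,N\}$ with $f(a)<f(b)$ whenever $a<_X b$. For $1\le i\le N-1$ the Bender–Knuth involution $t_i$ swaps labels $i$ and $i+1$ if $f^{ -1}(i)$, $f^{ -1}(i+1)$ are incomparable, and does nothing otherwise. Products denote composition, rightmost first. $q_0=\mathrm{id}$, $q_i=t_1(t_2t_1)\cdots(t_it_{i-1}\cdots t_1)$, $q_{jk}=q_{k-1}q_{k-j}q_{k-1}$. $X\oplus Y$: ordinal sum (all of $X$ below all of $Y$); $+$: disjoint union; $C_m$: $m$-element chain. For $n>1$, $\mathfrak{D}_n$ is the set of posets $C_{\lambda_1}+\cdots+C_{\lambda_\ell}$ with $\lambda\vdash n$, $\ell>1$; $\mathfrak{D}_1=\{C_1\}$. -}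

module Defs where

open import Data.Nat using (ℕ; zero; suc; _+_; _∸_; _≤_; _≥_; _≟_)
open import Data.Fin using (Fin; toℕ; splitAt)
import Data.Fin as F
open import Data.Fin.Properties using (any?)
open import Data.List using (List; []; _∷_; length)
open import Data.Nat.ListAction using (sum)
open import Data.List.Relation.Unary.All using (All)
open import Data.List.Relation.Unary.Linked using (Linked)
open import Data.Sum using (_⊎_; inj₁; inj₂)
open import Data.Product using (_×_; _,_; proj₁)
open import Data.Unit using (⊤; tt)
open import Data.Empty using (⊥)
open import Data.Bool using (Bool; true; false)
open import Relation.Nullary using (Dec; yes; no; ¬_; ¬?)
open import Relation.Nullary.Decidable using (_×-dec_; _⊎-dec_)
open import Relation.Binary using (Decidable; IsStrictPartialOrder)
open import Relation.Binary.PropositionalEquality using (_≡_)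
open import Function using (_∘_; id)
open import Function.Definitions using (Bijective)

record DRel (n : ℕ) : Set₁ where
  field
    _≺_  : Fin n → Fin n → Set
    _≺?_ : Decidable _≺_
open DRel public

IsPoset : ∀ {n} → DRel n → Set
IsPoset R = IsStrictPartialOrder _≡_ (_≺_ R)

chain : (m : ℕ) → DRel m
chain m = record { _≺_ = F._<_ ; _≺?_ = F._<?_ }

crossRel : Bool → Set
crossRel true  = ⊤
crossRel false = ⊥

crossRel? : (c : Bool) → Dec (crossRel c)
crossRel? true  = yes tt
crossRel? false = no (λ ())

-- Relation on a sum of carriers; the Bool says whether everything on the left is
-- below everything on the right (true: ordinal sum, false: disjoint union).
module _ {a b : ℕ} (cross : Bool) (R : DRel a) (S : DRel b) where
  sumRel : Fin a ⊎ Fin b → Fin a ⊎ Fin b → Set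
  sumRel (inj₁ u) (inj₁ v) = _≺_ R u v
  sumRel (inj₂ u) (inj₂ v) = _≺_ S u v
  sumRel (inj₁ u) (inj₂ v) = crossRel cross
  sumRel (inj₂ u) (inj₁ v) = ⊥

  sumRel? : Decidable sumRel
  sumRel? (inj₁ u) (inj₁ v) = _≺?_ R u v
  sumRel? (inj₂ u) (inj₂ v) = _≺?_ S u v
  sumRel? (inj₁ u) (inj₂ v) = crossRel? cross
  sumRel? (inj₂ u) (inj₁ v) = no (λ ())

  -- elements of Fin (a + b): the first a come from the left summand
  sumDRel : DRel (a + b)
  sumDRel = record
    { _≺_  = λ x y → sumRel (splitAt a x) (splitAt a y)
    ; _≺?_ = λ x y → sumRel? (splitAt a x) (splitAt a y) }

_⊕_ : ∀ {a b} → DRel a → DRel b → DRel (a + b)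
_⊕_ = sumDRel true

_⊞_ : ∀ {a b} → DRel a → DRel b → DRel (a + b)
_⊞_ = sumDRel false

Dλ : (ls : List ℕ) → DRel (sum ls)
Dλ []       = chain 0
Dλ (m ∷ ls) = chain m ⊞ Dλ ls

-- λ is a partition (positive, weakly decreasing parts) and D_λ ∈ 𝔇_n (n = sum λ):
-- either ℓ > 1, or λ = (1) (the case n = 1, D = C_1).
IsDPartition : List ℕ → Set
IsDPartition ls = All (λ m → 1 ≤ m) ls × Linked _≥_ ls × (2 ≤ length ls ⊎ ls ≡ 1 ∷ [])

Rposet : ∀ {p q} → DRel p → (ls : List ℕ) → DRel q → DRel (p + sum ls + q)
Rposet P ls Q = (P ⊕ Dλ ls) ⊕ Q

-- Labelings f : X → Fin N; the label of x is 1 + toℕ (f x) ∈ {1,…,N}.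
label : ∀ {N} → (Fin N → Fin N) → Fin N → ℕ
label f x = suc (toℕ (f x))

IsLinExt : ∀ {N} → DRel N → (Fin N → Fin N) → Set
IsLinExt R f = Bijective _≡_ _≡_ f × (∀ x y → _≺_ R x y → toℕ (f x) Data.Nat.< toℕ (f y))
  where import Data.Nat

Comparable : ∀ {N} → DRel N → Fin N → Fin N → Set
Comparable R x y = _≺_ R x y ⊎ _≺_ R y x

Partner : ∀ {N} → DRel N → ℕ → (Fin N → Fin N) → Fin N → Fin N → Set
Partner R i f x y =
  ((label f x ≡ i × label f y ≡ suc i) ⊎ (label f x ≡ suc i × label f y ≡ i))
  × ¬ Comparable R x y

Partner? : ∀ {N} (R : DRel N) i f x y → Dec (Partner R i f x y)
Partner? R i f x y =
  (((label f x ≟ i) ×-dec (label f y ≟ suc i)) ⊎-dec ((label f x ≟ suc i) ×-dec (label f y ≟ i)))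
  ×-dec ¬? (_≺?_ R x y ⊎-dec _≺?_ R y x)

t : ∀ {N} → DRel N → ℕ → (Fin N → Fin N) → (Fin N → Fin N)
t R i f x with any? (Partner? R i f x)
... | yes (y , _) = f y
... | no  _       = f x

tdown : ∀ {N} → DRel N → ℕ → (Fin N → Fin N) → (Fin N → Fin N)
tdown R zero    = id
tdown R (suc i) = t R (suc i) ∘ tdown R i

-- q_0 = id, q_i = t_1 (t_2 t_1) ⋯ (t_i ⋯ t_1) = q_{i-1} ∘ (t_i ⋯ t_1)
qq : ∀ {N} → DRel N → ℕ → (Fin N → Fin N) → (Fin N → Fin N)
qq R zero    = id
qq R (suc i) = qq R i ∘ tdown R (suc i)

qjk : ∀ {N} → DRel N → ℕ → ℕ → (Fin N → Fin N) → (Fin N → Fin N)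
qjk R j k = qq R (k ∸ 1) ∘ qq R (k ∸ j) ∘ qq R (k ∸ 1)

{-# OPTIONS --safe #-}
module Submission where

-- On linear extensions t_i is an involution, and t_a, t_b commute when |a − b| ≥ 2; from this
-- q_n t_{n+1} ⋯ t_1 = t_1 ⋯ t_{n+1} q_n, hence q_n and q_{jk} are involutions.
-- In R = P ⊕ D ⊕ Q every element of D lies above all of P, so its label exceeds p, and every
-- element incomparable to an element of D lies in D. Hence t_m, and so q_m, leaves the labels on D
-- unchanged when m ≤ p, and all the operators map labelings agreeing on D to labelings agreeing on D.
-- If i ≤ p both t_i drop out on D and q_{jk}² = id remains; if k − j ≤ p the middle factor
-- q_{k−j} drops out on D, so q_{jk} f agrees with q_{k−1}² f = f there, and t_i² = id remains.

open import Data.Nat using (ℕ; zero; suc; _+_; _∸_; _≤_; _<_; _≟_; s≤s; s≤s⁻¹)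
open import Data.Nat.Properties
  using (≤-refl; ≤-trans; m≤n⇒m≤1+n; ≤-<-trans; <-trans; <-irrefl; n<1+n; ≤∧≢⇒<; <⇒≢; >⇒≢; suc-injective; 1+n≢n)
open import Data.Fin using (Fin; toℕ; splitAt; _↑ˡ_; _↑ʳ_)
import Data.Fin as Fin
open import Data.Fin.Properties
  using (any?; toℕ-injective; toℕ-fromℕ<; injective⇒≤; ↑ˡ-injective; splitAt-↑ˡ; splitAt-↑ʳ; splitAt⁻¹-↑ˡ; splitAt⁻¹-↑ʳ)
import Data.Fin.Permutation as Permutation
open import Data.Fin.Permutation.Components using (transpose; transpose-inverse)
open import Data.List using (List)
open import Data.Nat.ListAction using (sum)
open import Data.Product using (∃; ∃₂; _×_; _,_; proj₁; proj₂)
open import Data.Sum using (_⊎_; inj₁; inj₂; swap)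
open import Data.Unit using (⊤; tt)
open import Data.Empty using (⊥-elim)
open import Relation.Nullary using (Dec; yes; no; ¬_; ¬?)
open import Relation.Nullary.Decidable using (dec-true; dec-false; _×-dec_; _⊎-dec_)
open import Relation.Binary.PropositionalEquality
  using (_≡_; _≢_; _≗_; refl; sym; trans; cong; subst; subst₂; module ≡-Reasoning)
open import Function using (_∘_; id)
open import Function.Definitions using (Bijective; Injective; Surjective)
open import Function.Bundles using (Bijection)
open import Function.Properties.Inverse using (↔⇒⤖)
import Function.Construct.Composition as Composition
open import Defs

module _ {n : ℕ} where

  transpose-matchˡ : (i j : Fin n) → transpose i j i ≡ j
  transpose-matchˡ i j rewrite dec-true (i Fin.≟ i) refl = refl

  transpose-matchʳ : (i j : Fin n) → transpose i j j ≡ i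
  transpose-matchʳ i j with j Fin.≟ i
  ... | yes j≡i = j≡i
  ... | no _ rewrite dec-true (j Fin.≟ j) refl = refl

  transpose-mismatch : {i j k : Fin n} → k ≢ i → k ≢ j → transpose i j k ≡ k
  transpose-mismatch {i} {j} {k} k≢i k≢j rewrite dec-false (k Fin.≟ i) k≢i | dec-false (k Fin.≟ j) k≢j = refl

  transpose-comm : {i j k l : Fin n} → i ≢ k × i ≢ l × j ≢ k × j ≢ l →
                   ∀ z → transpose i j (transpose k l z) ≡ transpose k l (transpose i j z)
  transpose-comm {i} {j} {k} {l} (i≢k , i≢l , j≢k , j≢l) z = by-cases (z Fin.≟ i) (z Fin.≟ j) (z Fin.≟ k) (z Fin.≟ l)
    where
    by-cases : Dec (z ≡ i) → Dec (z ≡ j) → Dec (z ≡ k) → Dec (z ≡ l) →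
               transpose i j (transpose k l z) ≡ transpose k l (transpose i j z)
    by-cases (yes refl) _ _ _
      rewrite transpose-mismatch i≢k i≢l | transpose-matchˡ i j | transpose-mismatch j≢k j≢l = refl
    by-cases (no _) (yes refl) _ _
      rewrite transpose-mismatch j≢k j≢l | transpose-matchʳ i j | transpose-mismatch i≢k i≢l = refl
    by-cases (no z≢i) (no z≢j) (yes refl) _
      rewrite transpose-matchˡ k l | transpose-mismatch z≢i z≢j
            | transpose-mismatch (i≢l ∘ sym) (j≢l ∘ sym) | transpose-matchˡ k l = refl
    by-cases (no z≢i) (no z≢j) (no _) (yes refl)
      rewrite transpose-matchʳ k l | transpose-mismatch z≢i z≢j
            | transpose-mismatch (i≢k ∘ sym) (j≢k ∘ sym) | transpose-matchʳ k l = refl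
    by-cases (no z≢i) (no z≢j) (no z≢k) (no z≢l)
      rewrite transpose-mismatch z≢k z≢l | transpose-mismatch z≢i z≢j | transpose-mismatch z≢k z≢l = refl

  transpose-bijective : (i j : Fin n) → Bijective _≡_ _≡_ (transpose i j)
  transpose-bijective i j = Bijection.bijective (↔⇒⤖ (Permutation.transpose i j))

module BenderKnuth {N : ℕ} (R : DRel N) where

  private variable
    i a b : ℕ
    f g : Fin N → Fin N
    x y u v w : Fin N

  label-injective : (f : Fin N → Fin N) → label f x ≡ label f y → f x ≡ f y
  label-injective _ = toℕ-injective ∘ suc-injective

  IsLinExt-injective : IsLinExt R f → f x ≡ f y → x ≡ y
  IsLinExt-injective ((f-injective , _) , _) = f-injective

  IsLinExt-resp : f ≗ g → IsLinExt R f → IsLinExt R g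
  IsLinExt-resp {f} {g} f≗g ((f-injective , f-surjective) , monotone) =
    (g-injective , g-surjective) ,
    λ x y x≺y → subst₂ _<_ (cong toℕ (f≗g x)) (cong toℕ (f≗g y)) (monotone x y x≺y)
    where
    g-injective : g x ≡ g y → x ≡ y
    g-injective {x} {y} gx≡gy = f-injective (trans (f≗g x) (trans gx≡gy (sym (f≗g y))))
    g-surjective : Surjective _≡_ _≡_ g
    g-surjective v with f-surjective v
    ... | (x , fx≡v) = x , λ {z} z≡x → trans (sym (f≗g z)) (fx≡v z≡x)

  label-above-strict-down-set : ∀ {m} → IsLinExt R f → (e : Fin m → Fin N) → Injective _≡_ _≡_ e →
                                (∀ a → _≺_ R (e a) y) → m < label f y
  label-above-strict-down-set {f} {y} {m} L@(_ , monotone) e e-injective below =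
    s≤s (injective⇒≤ {f = rank} rank-injective)
    where
    rank : Fin m → Fin (toℕ (f y))
    rank a = Fin.fromℕ< (monotone _ _ (below a))
    rank-injective : Injective _≡_ _≡_ rank
    rank-injective {a} {b} ra≡rb = e-injective (IsLinExt-injective L (toℕ-injective (begin
      toℕ (f (e a))  ≡⟨ toℕ-fromℕ< (monotone _ _ (below a)) ⟨
      toℕ (rank a)   ≡⟨ cong toℕ ra≡rb ⟩
      toℕ (rank b)   ≡⟨ toℕ-fromℕ< (monotone _ _ (below b)) ⟩
      toℕ (f (e b))  ∎)))
      where open ≡-Reasoning

  t-partner : Partner R i f x w → t R i f x ≡ f w
  t-partner {i} {f} {x} p with any? (Partner? R i f x)
  ... | yes (w′ , p′) = same-label p′ p
    where
    same-label : Partner R i f x w′ → Partner R i f x w → f w′ ≡ f w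
    same-label (inj₁ (_ , l′) , _) (inj₁ (_ , l) , _) = label-injective f (trans l′ (sym l))
    same-label (inj₂ (_ , l′) , _) (inj₂ (_ , l) , _) = label-injective f (trans l′ (sym l))
    same-label (inj₁ (l′ , _) , _) (inj₂ (l , _) , _) = ⊥-elim (1+n≢n (trans (sym l) l′))
    same-label (inj₂ (l′ , _) , _) (inj₁ (l , _) , _) = ⊥-elim (1+n≢n (trans (sym l′) l))
  ... | no none = ⊥-elim (none (_ , p))

  t-no-partner : (∀ w → ¬ Partner R i f x w) → t R i f x ≡ f x
  t-no-partner {i} {f} {x} none with any? (Partner? R i f x)
  ... | yes (w , p) = ⊥-elim (none w p)
  ... | no _ = refl

  IncomparabilityClosed : (Fin N → Set) → Set
  IncomparabilityClosed S = ∀ {x y} → S x → ¬ Comparable R x y → S y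

  AgreeOn : (Fin N → Set) → (f g : Fin N → Fin N) → Set
  AgreeOn S f g = ∀ {x} → S x → f x ≡ g x

  partner-transport : f x ≡ g x → f w ≡ g w → Partner R i f x w → Partner R i g x w
  partner-transport {f} {x} {g} {w} fx≡gx fw≡gw p
    rewrite fx≡gx | fw≡gw = p

  -- The t_i-partner of a point of S lies in S, so t R i f reads f only on S.
  t-respects : {S : Fin N → Set} → IncomparabilityClosed S →
               AgreeOn S f g → AgreeOn S (t R i f) (t R i g)
  t-respects {f} {g} {i} {S} closed agree {x} x∈S with any? (Partner? R i f x)
  ... | yes (w , p) = trans (agree w∈S) (sym (t-partner (partner-transport (agree x∈S) (agree w∈S) p)))
    where
    w∈S : S w
    w∈S = closed x∈S (proj₂ p)
  ... | no none = trans (agree x∈S) (sym (t-no-partner none′))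
    where
    none′ : ∀ w → ¬ Partner R i g x w
    none′ w p = none (w , partner-transport (sym (agree x∈S)) (sym (agree (closed x∈S (proj₂ p)))) p)

  t-cong : f ≗ g → t R i f ≗ t R i g
  t-cong f≗g x = t-respects {S = λ _ → ⊤} (λ _ _ → tt) (λ {y} _ → f≗g y) tt

  t-fixes-above : {S : Fin N → Set} → IncomparabilityClosed S →
                  (∀ {x} → S x → i < label f x) → AgreeOn S (t R i f) f
  t-fixes-above {i} {f} closed above {x} x∈S = t-no-partner none
    where
    none : ∀ w → ¬ Partner R i f x w
    none w (inj₁ (lx , _) , _) = <-irrefl (sym lx) (above x∈S)
    none w (inj₂ (_ , lw) , incomparable) = <-irrefl (sym lw) (above (closed x∈S incomparable))

  IsPair : ℕ → (Fin N → Fin N) → Fin N → Fin N → Set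
  IsPair i f x y = label f x ≡ i × label f y ≡ suc i × ¬ Comparable R x y

  Swappable : ℕ → (Fin N → Fin N) → Set
  Swappable i f = ∃₂ (IsPair i f)

  swappable? : ∀ i f → Dec (Swappable i f)
  swappable? i f = any? λ x → any? λ y →
    (label f x ≟ i) ×-dec (label f y ≟ suc i) ×-dec ¬? (_≺?_ R x y ⊎-dec _≺?_ R y x)

  pair-flip : IsPair i f x y → IsPair i (f ∘ transpose x y) y x
  pair-flip {f = f} {x} {y} (lx , ly , incomparable) =
    trans (cong (label f) (transpose-matchʳ x y)) lx ,
    trans (cong (label f) (transpose-matchˡ x y)) ly ,
    incomparable ∘ swap

  t-on-pair : IsLinExt R f → IsPair i f x y → t R i f ≗ f ∘ transpose x y
  t-on-pair {f} {i} {x} {y} L (lx , ly , incomparable) z = by-cases (z Fin.≟ x) (z Fin.≟ y)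
    where
    by-cases : Dec (z ≡ x) → Dec (z ≡ y) → t R i f z ≡ f (transpose x y z)
    by-cases (yes refl) _ =
      trans (t-partner (inj₁ (lx , ly) , incomparable)) (cong f (sym (transpose-matchˡ x y)))
    by-cases (no _) (yes refl) =
      trans (t-partner (inj₂ (ly , lx) , incomparable ∘ swap)) (cong f (sym (transpose-matchʳ x y)))
    by-cases (no z≢x) (no z≢y) = trans (t-no-partner none) (cong f (sym (transpose-mismatch z≢x z≢y)))
      where
      none : ∀ w → ¬ Partner R i f z w
      none w (inj₁ (lz , _) , _) = z≢x (IsLinExt-injective L (label-injective f (trans lz (sym lx))))
      none w (inj₂ (lz , _) , _) = z≢y (IsLinExt-injective L (label-injective f (trans lz (sym ly))))

  t-off-pair : ¬ Swappable i f → t R i f ≗ f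
  t-off-pair none z = t-no-partner λ where
    w (inj₁ (lz , lw) , incomparable) → none (z , w , lz , lw , incomparable)
    w (inj₂ (lz , lw) , incomparable) → none (w , z , lw , lz , incomparable ∘ swap)

  IsLinExt-∘transpose : IsLinExt R f → IsPair i f x y → IsLinExt R (f ∘ transpose x y)
  IsLinExt-∘transpose {f} {i} {x} {y} L@(f-bijective , monotone) (lx , ly , incomparable) =
    Composition.bijective _≡_ _≡_ _≡_ (transpose-bijective x y) f-bijective , monotone′
    where
    F : Fin N → ℕ
    F = toℕ ∘ f
    Fy≡1+Fx : F y ≡ suc (F x)
    Fy≡1+Fx = suc-injective (trans ly (cong suc (sym lx)))
    F-distinct : u ≢ v → F u ≢ F v
    F-distinct u≢v = u≢v ∘ IsLinExt-injective L ∘ toℕ-injective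
    monotone′ : ∀ a b → _≺_ R a b → F (transpose x y a) < F (transpose x y b)
    monotone′ a b a≺b = by-cases (a Fin.≟ x) (a Fin.≟ y) (b Fin.≟ x) (b Fin.≟ y)
      where
      by-cases : Dec (a ≡ x) → Dec (a ≡ y) → Dec (b ≡ x) → Dec (b ≡ y) →
                 F (transpose x y a) < F (transpose x y b)
      by-cases (yes refl) _ _ (yes refl) = ⊥-elim (incomparable (inj₁ a≺b))
      by-cases (yes refl) _ (yes refl) _ = ⊥-elim (<-irrefl refl (monotone a b a≺b))
      by-cases (yes refl) _ (no b≢x) (no b≢y)
        rewrite transpose-matchˡ x y | transpose-mismatch b≢x b≢y =
        subst (_< F b) (sym Fy≡1+Fx)
          (≤∧≢⇒< (monotone a b a≺b) (F-distinct (b≢y ∘ sym) ∘ trans Fy≡1+Fx))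
      by-cases (no _) (yes refl) (yes refl) _ = ⊥-elim (incomparable (inj₂ a≺b))
      by-cases (no _) (yes refl) _ (yes refl) = ⊥-elim (<-irrefl refl (monotone a b a≺b))
      by-cases (no _) (yes refl) (no b≢x) (no b≢y)
        rewrite transpose-matchʳ x y | transpose-mismatch b≢x b≢y =
        <-trans (subst (F x <_) (sym Fy≡1+Fx) (n<1+n (F x))) (monotone a b a≺b)
      by-cases (no a≢x) (no a≢y) (yes refl) _
        rewrite transpose-matchˡ x y | transpose-mismatch a≢x a≢y =
        <-trans (monotone a b a≺b) (subst (F x <_) (sym Fy≡1+Fx) (n<1+n (F x)))
      by-cases (no a≢x) (no a≢y) (no _) (yes refl)
        rewrite transpose-matchʳ x y | transpose-mismatch a≢x a≢y =
        ≤∧≢⇒< (s≤s⁻¹ (subst (F a <_) Fy≡1+Fx (monotone a b a≺b))) (F-distinct a≢x)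
      by-cases (no a≢x) (no a≢y) (no b≢x) (no b≢y)
        rewrite transpose-mismatch a≢x a≢y | transpose-mismatch b≢x b≢y = monotone a b a≺b

  t-preserves-IsLinExt : ∀ i → IsLinExt R f → IsLinExt R (t R i f)
  t-preserves-IsLinExt {f} i L with swappable? i f
  ... | yes (x , y , p) = IsLinExt-resp (sym ∘ t-on-pair L p) (IsLinExt-∘transpose L p)
  ... | no none = IsLinExt-resp (sym ∘ t-off-pair none) L

  t-involutive : ∀ i → IsLinExt R f → t R i (t R i f) ≗ f
  t-involutive {f} i L z with swappable? i f
  ... | yes (x , y , p) = begin
    t R i (t R i f) z                         ≡⟨ t-cong (t-on-pair L p) z ⟩
    t R i (f ∘ transpose x y) z               ≡⟨ t-on-pair (IsLinExt-∘transpose L p) (pair-flip p) z ⟩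
    f (transpose x y (transpose y x z))       ≡⟨ cong f (transpose-inverse x y) ⟩
    f z                                       ∎
    where open ≡-Reasoning
  ... | no none = trans (t-cong (t-off-pair none) z) (t-off-pair none z)

  FarApart : ℕ → ℕ → Set
  FarApart a b = suc a < b ⊎ suc b < a

  Outside : ℕ → ℕ → Set
  Outside a n = n < a ⊎ suc a < n

  far⇒outside : FarApart a b → Outside a b × Outside a (suc b)
  far⇒outside {a} {b} (inj₁ 1+a<b) = inj₂ 1+a<b , inj₂ (<-trans 1+a<b (n<1+n b))
  far⇒outside {a} {b} (inj₂ 1+b<a) = inj₁ (<-trans (n<1+n b) 1+b<a) , inj₁ 1+b<a

  outside-pair : IsPair a f x y → Outside a (label f u) → u ≢ x × u ≢ y
  outside-pair {a} {f} (lx , ly , _) out =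
    (λ { refl → outside-lower out lx }) , (λ { refl → outside-upper out ly })
    where
    outside-lower : ∀ {n} → Outside a n → n ≢ a
    outside-lower (inj₁ n<a) = <⇒≢ n<a
    outside-lower (inj₂ 1+a<n) = >⇒≢ (<-trans (n<1+n a) 1+a<n)
    outside-upper : ∀ {n} → Outside a n → n ≢ suc a
    outside-upper (inj₁ n<a) = <⇒≢ (<-trans n<a (n<1+n a))
    outside-upper (inj₂ 1+a<n) = >⇒≢ 1+a<n

  pairs-disjoint : FarApart a b → IsPair a f x y → IsPair b f u v → u ≢ x × u ≢ y × v ≢ x × v ≢ y
  pairs-disjoint far p (lu , lv , _)
    with outside-pair p (subst (Outside _) (sym lu) (proj₁ (far⇒outside far)))
       | outside-pair p (subst (Outside _) (sym lv) (proj₂ (far⇒outside far)))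
  ... | u≢x , u≢y | v≢x , v≢y = u≢x , u≢y , v≢x , v≢y

  pair-∘transpose : FarApart a b → IsPair a f x y → IsPair b f u v → IsPair b (f ∘ transpose x y) u v
  pair-∘transpose {f = f} far p q@(lu , lv , incomparable) with pairs-disjoint far p q
  ... | u≢x , u≢y , v≢x , v≢y =
    trans (cong (label f) (transpose-mismatch u≢x u≢y)) lu ,
    trans (cong (label f) (transpose-mismatch v≢x v≢y)) lv ,
    incomparable

  pair-∘transpose⁻ : FarApart a b → IsPair a f x y → IsPair b (f ∘ transpose x y) u v → IsPair b f u v
  pair-∘transpose⁻ {f = f} far p q@(lu , lv , incomparable) with pairs-disjoint far (pair-flip p) q
  ... | u≢y , u≢x , v≢y , v≢x =
    trans (cong (label f) (sym (transpose-mismatch u≢x u≢y))) lu ,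
    trans (cong (label f) (sym (transpose-mismatch v≢x v≢y))) lv ,
    incomparable

  private
    t-comm-one-sided : FarApart a b → IsLinExt R f → IsPair a f x y → ¬ Swappable b f →
                       t R a (t R b f) ≗ t R b (t R a f)
    t-comm-one-sided {a} {b} {f} {x} {y} far L p none z = begin
      t R a (t R b f) z          ≡⟨ t-cong (t-off-pair none) z ⟩
      t R a f z                  ≡⟨ t-on-pair L p z ⟩
      f (transpose x y z)        ≡⟨ t-off-pair none′ z ⟨
      t R b (f ∘ transpose x y) z ≡⟨ t-cong (t-on-pair L p) z ⟨
      t R b (t R a f) z          ∎
      where
      open ≡-Reasoning
      none′ : ¬ Swappable b (f ∘ transpose x y)
      none′ (u , v , q) = none (u , v , pair-∘transpose⁻ far p q)

  t-comm : FarApart a b → IsLinExt R f → t R a (t R b f) ≗ t R b (t R a f)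
  t-comm {a} {b} {f} far L z with swappable? a f | swappable? b f
  ... | yes (_ , _ , p) | no none = t-comm-one-sided far L p none z
  ... | no none | yes (_ , _ , q) = sym (t-comm-one-sided (swap far) L q none z)
  ... | no none-a | no none-b = begin
    t R a (t R b f) z   ≡⟨ t-cong (t-off-pair none-b) z ⟩
    t R a f z           ≡⟨ t-off-pair none-a z ⟩
    f z                 ≡⟨ t-off-pair none-b z ⟨
    t R b f z           ≡⟨ t-cong (t-off-pair none-a) z ⟨
    t R b (t R a f) z   ∎
    where open ≡-Reasoning
  ... | yes (x₀ , y₀ , p) | yes (x₁ , y₁ , q) = begin
    t R a (t R b f) z                         ≡⟨ t-cong (t-on-pair L q) z ⟩
    t R a (f ∘ transpose x₁ y₁) z             ≡⟨ t-on-pair (IsLinExt-∘transpose L q) (pair-∘transpose (swap far) q p) z ⟩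
    f (transpose x₁ y₁ (transpose x₀ y₀ z))   ≡⟨ cong f (transpose-comm (pairs-disjoint (swap far) q p) z) ⟨
    f (transpose x₀ y₀ (transpose x₁ y₁ z))   ≡⟨ t-on-pair (IsLinExt-∘transpose L p) (pair-∘transpose far p q) z ⟨
    t R b (f ∘ transpose x₀ y₀) z             ≡⟨ t-cong (t-on-pair L p) z ⟨
    t R b (t R a f) z                         ∎
    where open ≡-Reasoning

  tup : ℕ → (Fin N → Fin N) → (Fin N → Fin N)
  tup zero    = id
  tup (suc i) = tup i ∘ t R (suc i)

  module Closure (Good : ((Fin N → Fin N) → (Fin N → Fin N)) → Set)
                 (good-id : Good id)
                 (good-∘ : ∀ {A B} → Good A → Good B → Good (A ∘ B)) where

    tdown-good : ∀ k → (∀ {m} → m ≤ k → Good (t R m)) → Good (tdown R k)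
    tdown-good zero    _      = good-id
    tdown-good (suc k) good-t = good-∘ (good-t ≤-refl) (tdown-good k (good-t ∘ m≤n⇒m≤1+n))

    tup-good : ∀ k → (∀ {m} → m ≤ k → Good (t R m)) → Good (tup k)
    tup-good zero    _      = good-id
    tup-good (suc k) good-t = good-∘ (tup-good k (good-t ∘ m≤n⇒m≤1+n)) (good-t ≤-refl)

    qq-good : ∀ k → (∀ {m} → m ≤ k → Good (t R m)) → Good (qq R k)
    qq-good zero    _      = good-id
    qq-good (suc k) good-t = good-∘ (qq-good k (good-t ∘ m≤n⇒m≤1+n)) (tdown-good (suc k) good-t)

    qjk-good : ∀ j k → (∀ m → Good (t R m)) → Good (qjk R j k)
    qjk-good j k good-t = good-∘ (good-qq (k ∸ 1)) (good-∘ (good-qq (k ∸ j)) (good-qq (k ∸ 1)))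
      where
      good-qq : ∀ l → Good (qq R l)
      good-qq l = qq-good l (λ {m} _ → good-t m)

  PreservesIsLinExt : ((Fin N → Fin N) → (Fin N → Fin N)) → Set
  PreservesIsLinExt A = ∀ {f} → IsLinExt R f → IsLinExt R (A f)

  Congruent : ((Fin N → Fin N) → (Fin N → Fin N)) → Set
  Congruent A = ∀ {f g} → f ≗ g → A f ≗ A g

  RespectsAgreeOn : (Fin N → Set) → ((Fin N → Fin N) → (Fin N → Fin N)) → Set
  RespectsAgreeOn S A = ∀ {f g} → AgreeOn S f g → AgreeOn S (A f) (A g)

  module Preserving = Closure PreservesIsLinExt id (λ A-pres B-pres → A-pres ∘ B-pres)
  module Congruence = Closure Congruent id (λ A-cong B-cong → A-cong ∘ B-cong)
  module Respecting (S : Fin N → Set) = Closure (RespectsAgreeOn S) id (λ A-resp B-resp → A-resp ∘ B-resp)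

  tdown-preserves-IsLinExt : ∀ k → PreservesIsLinExt (tdown R k)
  tdown-preserves-IsLinExt k = Preserving.tdown-good k (λ {m} _ → t-preserves-IsLinExt m)

  qq-preserves-IsLinExt : ∀ k → PreservesIsLinExt (qq R k)
  qq-preserves-IsLinExt k = Preserving.qq-good k (λ {m} _ → t-preserves-IsLinExt m)

  qjk-preserves-IsLinExt : ∀ j k → PreservesIsLinExt (qjk R j k)
  qjk-preserves-IsLinExt j k = Preserving.qjk-good j k (λ m → t-preserves-IsLinExt m)

  tup-cong : ∀ k → Congruent (tup k)
  tup-cong k = Congruence.tup-good k (λ _ → t-cong)

  qq-cong : ∀ k → Congruent (qq R k)
  qq-cong k = Congruence.qq-good k (λ _ → t-cong)

  qq-respects : {S : Fin N → Set} → IncomparabilityClosed S → ∀ k → RespectsAgreeOn S (qq R k)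
  qq-respects {S} closed k = Respecting.qq-good S k (λ _ → t-respects closed)

  qjk-respects : {S : Fin N → Set} → IncomparabilityClosed S → ∀ j k → RespectsAgreeOn S (qjk R j k)
  qjk-respects {S} closed j k = Respecting.qjk-good S j k (λ _ → t-respects closed)

  tup-tdown : ∀ k → IsLinExt R f → tup k (tdown R k f) ≗ f
  tup-tdown zero    L z = refl
  tup-tdown (suc k) L z =
    trans (tup-cong k (t-involutive (suc k) (tdown-preserves-IsLinExt k L)) z) (tup-tdown k L z)

  tdown-t-comm : ∀ k {m} → suc k < m → IsLinExt R f → tdown R k (t R m f) ≗ t R m (tdown R k f)
  tdown-t-comm zero    _     _ z = refl
  tdown-t-comm (suc k) k+2<m L z =
    trans (t-cong (tdown-t-comm k (<-trans (n<1+n _) k+2<m) L) z)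
          (t-comm (inj₁ k+2<m) (tdown-preserves-IsLinExt k L) z)

  qq-t-comm : ∀ k {m} → suc k < m → IsLinExt R f → qq R k (t R m f) ≗ t R m (qq R k f)
  qq-t-comm zero    _     _ z = refl
  qq-t-comm (suc k) k+2<m L z =
    trans (qq-cong k (tdown-t-comm (suc k) k+2<m L) z)
          (qq-t-comm k (<-trans (n<1+n _) k+2<m) (tdown-preserves-IsLinExt (suc k) L) z)

  qq-tdown : ∀ k → IsLinExt R f → qq R k (tdown R (suc k) f) ≗ tup (suc k) (qq R k f)
  qq-tdown zero    L z = refl
  qq-tdown {f} (suc k) L z = begin
    qq R k (tdown R (suc k) (t R (2 + k) h)) z  ≡⟨ qq-tdown k (t-preserves-IsLinExt (2 + k) Lh) z ⟩
    tup (suc k) (qq R k (t R (2 + k) h)) z      ≡⟨ tup-cong (suc k) (qq-t-comm k ≤-refl Lh) z ⟩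
    tup (suc k) (t R (2 + k) (qq R k h)) z      ∎
    where
    open ≡-Reasoning
    h : Fin N → Fin N
    h = tdown R (suc k) f
    Lh : IsLinExt R h
    Lh = tdown-preserves-IsLinExt (suc k) L

  qq-involutive : ∀ k → IsLinExt R f → qq R k (qq R k f) ≗ f
  qq-involutive zero    L z = refl
  qq-involutive {f} (suc k) L z = begin
    qq R k (tdown R (suc k) (qq R k h)) z   ≡⟨ qq-tdown k (qq-preserves-IsLinExt k Lh) z ⟩
    tup (suc k) (qq R k (qq R k h)) z       ≡⟨ tup-cong (suc k) (qq-involutive k Lh) z ⟩
    tup (suc k) h z                         ≡⟨ tup-tdown (suc k) L z ⟩
    f z                                     ∎
    where
    open ≡-Reasoning
    h : Fin N → Fin N
    h = tdown R (suc k) f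
    Lh : IsLinExt R h
    Lh = tdown-preserves-IsLinExt (suc k) L

  qjk-involutive : ∀ j k → IsLinExt R f → qjk R j k (qjk R j k f) ≗ f
  qjk-involutive {f} j k L z = begin
    qq R outer (qq R middle (qq R outer (qq R outer (qq R middle (qq R outer f))))) z
      ≡⟨ qq-cong outer (qq-cong middle (qq-involutive outer (qq-preserves-IsLinExt middle (qq-preserves-IsLinExt outer L)))) z ⟩
    qq R outer (qq R middle (qq R middle (qq R outer f))) z
      ≡⟨ qq-cong outer (qq-involutive middle (qq-preserves-IsLinExt outer L)) z ⟩
    qq R outer (qq R outer f) z
      ≡⟨ qq-involutive outer L z ⟩
    f z ∎
    where
    open ≡-Reasoning
    outer middle : ℕ
    outer  = k ∸ 1
    middle = k ∸ j

  module _ {S : Fin N → Set} (closed : IncomparabilityClosed S) {p : ℕ}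
           (above-p : ∀ {f} → IsLinExt R f → ∀ {x} → S x → p < label f x) where

    t-fixes-low : ∀ {m} → m ≤ p → IsLinExt R f → AgreeOn S (t R m f) f
    t-fixes-low m≤p L = t-fixes-above closed (λ x∈S → ≤-<-trans m≤p (above-p L x∈S))

    FixesOn : ((Fin N → Fin N) → (Fin N → Fin N)) → Set
    FixesOn A = ∀ {f} → IsLinExt R f → IsLinExt R (A f) × AgreeOn S (A f) f

    fixes-id : FixesOn id
    fixes-id L = L , λ _ → refl

    fixes-∘ : ∀ {A B} → FixesOn A → FixesOn B → FixesOn (A ∘ B)
    fixes-∘ A-fixes B-fixes L with B-fixes L
    ... | LB , B-agrees with A-fixes LB
    ... | LAB , A-agrees = LAB , λ x∈S → trans (A-agrees x∈S) (B-agrees x∈S)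

    module Fixing = Closure FixesOn fixes-id fixes-∘

    qq-fixes-low : ∀ k → k ≤ p → IsLinExt R f → AgreeOn S (qq R k f) f
    qq-fixes-low k k≤p L = proj₂ (Fixing.qq-good k t-fixes L)
      where
      t-fixes : ∀ {m} → m ≤ k → FixesOn (t R m)
      t-fixes m≤k L = t-preserves-IsLinExt _ L , t-fixes-low (≤-trans m≤k k≤p) L

    qjk-fixes : ∀ j k → k ∸ j ≤ p → IsLinExt R f → AgreeOn S (qjk R j k f) f
    qjk-fixes {f} j k k∸j≤p L {x} x∈S = begin
      qq R (k ∸ 1) (qq R (k ∸ j) (qq R (k ∸ 1) f)) x
        ≡⟨ qq-respects closed (k ∸ 1) (qq-fixes-low (k ∸ j) k∸j≤p (qq-preserves-IsLinExt (k ∸ 1) L)) x∈S ⟩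
      qq R (k ∸ 1) (qq R (k ∸ 1) f) x
        ≡⟨ qq-involutive (k ∸ 1) L x ⟩
      f x ∎
      where open ≡-Reasoning

    bk-square-fixes : ∀ i j k → i ≤ p ⊎ k ∸ j ≤ p → IsLinExt R f →
                      AgreeOn S ((t R i ∘ qjk R j k ∘ t R i ∘ qjk R j k) f) f
    bk-square-fixes {f} i j k (inj₁ i≤p) L {x} x∈S = begin
      t R i (qjk R j k (t R i (qjk R j k f))) x
        ≡⟨ t-fixes-low i≤p (qjk-preserves-IsLinExt j k (t-preserves-IsLinExt i (qjk-preserves-IsLinExt j k L))) x∈S ⟩
      qjk R j k (t R i (qjk R j k f)) x
        ≡⟨ qjk-respects closed j k (t-fixes-low i≤p (qjk-preserves-IsLinExt j k L)) x∈S ⟩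
      qjk R j k (qjk R j k f) x
        ≡⟨ qjk-involutive j k L x ⟩
      f x ∎
      where open ≡-Reasoning
    bk-square-fixes {f} i j k (inj₂ k∸j≤p) L {x} x∈S = begin
      t R i (qjk R j k (t R i (qjk R j k f))) x
        ≡⟨ t-respects closed (qjk-fixes j k k∸j≤p (t-preserves-IsLinExt i (qjk-preserves-IsLinExt j k L))) x∈S ⟩
      t R i (t R i (qjk R j k f)) x
        ≡⟨ t-respects closed (t-respects closed (qjk-fixes j k k∸j≤p L)) x∈S ⟩
      t R i (t R i f) x
        ≡⟨ t-involutive i L x ⟩
      f x ∎
      where open ≡-Reasoning

module OrdinalSumBlocks {p q : ℕ} (P : DRel p) (ls : List ℕ) (Q : DRel q) where

  private
    n : ℕ
    n = sum ls
    R : DRel (p + n + q)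
    R = Rposet P ls Q

  data Block : Fin (p + n + q) → Set where
    in-P : ∀ x → Block ((x ↑ˡ n) ↑ˡ q)
    in-D : ∀ d → Block ((p ↑ʳ d) ↑ˡ q)
    in-Q : ∀ z → Block ((p + n) ↑ʳ z)

  block : ∀ y → Block y
  block y with splitAt (p + n) y in y-split
  ... | inj₂ z = subst Block (splitAt⁻¹-↑ʳ y-split) (in-Q z)
  ... | inj₁ w with splitAt p w in w-split
  ...   | inj₁ x = subst Block (trans (cong (_↑ˡ q) (splitAt⁻¹-↑ˡ w-split)) (splitAt⁻¹-↑ˡ y-split)) (in-P x)
  ...   | inj₂ d = subst Block (trans (cong (_↑ˡ q) (splitAt⁻¹-↑ʳ w-split)) (splitAt⁻¹-↑ˡ y-split)) (in-D d)

  P-below-D : ∀ x d → _≺_ R ((x ↑ˡ n) ↑ˡ q) ((p ↑ʳ d) ↑ˡ q)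
  P-below-D x d rewrite splitAt-↑ˡ (p + n) (x ↑ˡ n) q | splitAt-↑ˡ (p + n) (p ↑ʳ d) q
                      | splitAt-↑ˡ p x n | splitAt-↑ʳ p n d = tt

  D-below-Q : ∀ d z → _≺_ R ((p ↑ʳ d) ↑ˡ q) ((p + n) ↑ʳ z)
  D-below-Q d z rewrite splitAt-↑ˡ (p + n) (p ↑ʳ d) q | splitAt-↑ʳ (p + n) q z = tt

  InD : Fin (p + n + q) → Set
  InD y = ∃ λ d → y ≡ (p ↑ʳ d) ↑ˡ q

  open BenderKnuth R

  InD-closed : IncomparabilityClosed InD
  InD-closed {y = y} (d , refl) incomparable with block y
  ... | in-P x = ⊥-elim (incomparable (inj₂ (P-below-D x d)))
  ... | in-D d′ = d′ , refl
  ... | in-Q z = ⊥-elim (incomparable (inj₁ (D-below-Q d z)))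

  InD-above-p : ∀ {f} → IsLinExt R f → ∀ {y} → InD y → p < label f y
  InD-above-p L (d , refl) =
    label-above-strict-down-set L (λ x → (x ↑ˡ n) ↑ˡ q)
      (↑ˡ-injective n _ _ ∘ ↑ˡ-injective q _ _) (λ x → P-below-D x d)

lemma4p8 : (p q : ℕ) (P : DRel p) (Q : DRel q) → IsPoset P → IsPoset Q →
    (ls : List ℕ) → IsDPartition ls →
    (i j k : ℕ) → 1 ≤ i → suc i < j → j < k → k ≤ p + sum ls + q →
    (i ≤ p ⊎ k ∸ j ≤ p) →
    (f : Fin (p + sum ls + q) → Fin (p + sum ls + q)) → IsLinExt (Rposet P ls Q) f →
    (d : Fin (sum ls)) →
    (t (Rposet P ls Q) i ∘ qjk (Rposet P ls Q) j k ∘ t (Rposet P ls Q) i ∘ qjk (Rposet P ls Q) j k)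
    f ((p ↑ʳ d) ↑ˡ q)
    ≡ f ((p ↑ʳ d) ↑ˡ q)
lemma4p8 p q P Q _ _ ls _ i j k _ _ _ _ low f L d =
  bk-square-fixes InD-closed InD-above-p i j k low L (d , refl)
  where
  open OrdinalSumBlocks P ls Q
  open BenderKnuth (Rposet P ls Q)
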